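{- Let $\mathcal{V}$ and $\mathcal{W}$ be vector bundles on the Fargues–Fontaine curve $X$ such that $\mathcal{V}$ slopewise dominates $\mathcal{W}$. Then there exist vector bundles $\mathcal{U},\mathcal{V}',\mathcal{W}'$ with $\mathcal{V}\simeq\mathcal{U}\oplus\mathcal{V}'$ and $\mathcal{W}\simeq\mathcal{U}\oplus\mathcal{W}'$ such that: (i) $\mathcal{V}'$ slopewise dominates $\mathcal{W}'$; (ii) if $\mathcal{W}'\neq0$, then $\mu_{\max}(\mathcal{V}')>\mu_{\max}(\mathcal{W}')$; (iii) if $\mathcal{U}\neq0$ and $\mathcal{W}'\neq0$, then $\mu_{\min}(\mathcal{U})\geq\mu_{\max}(\mathcal{V}')>\mu_{\max}(\mathcal{W}')$.
   Context: $X$ is the Fargues–Fontaine curve attached to a finite extension $E/\mathbb{Q}_p$ and an algebraically closed perfectoid field $F$ of characteristic $p$. Every vector bundle $\mathcal{V}$ has a unique HN decomposition $\mathcal{V}\simeq\bigoplus_i\mathcal{O}(\lambda_i)^{\oplus m_i}$ ($\lambda_1>\lambda_2>\cdots$, $\mathcal{O}(\lambda)$ the stable bundle of slope $\lambda$); $\mu_{\max}$, $\mu_{\min}$ denote the largest and smallest HN slopes. $\mathrm{HN}(\mathcal{V})$ is the concave polygon from the origin with successive edges of slopes $\lambda_i$ and horizontal lengths $m_i\,\mathrm{rk}\,\mathcal{O}(\lambda_i)$. Definition: with both polygons starting at the origin, $\mathcal{V}$ slopewise dominates $\mathcal{W}$ if for each $i=1,\dots,\mathrm{rk}(\mathcal{W})$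 the slope of $\mathrm{HN}(\mathcal{W})$ on $[i-1,i]$ is at most the slope of $\mathrm{HN}(\mathcal{V})$ on $[i-1,i]$. -}

module Defs where

open import Data.Nat using (ℕ)
open import Data.Rational using (ℚ; 0ℚ; _≤_; _⊔_; _⊓_; ↧ₙ_)
open import Data.Rational.Properties using (≤-decTotalOrder)
open import Data.List using (List; []; _∷_; replicate; concatMap; length; reverse; foldr)
open import Data.Unit using (⊤)
open import Data.Empty using (⊥)
open import Data.Product using (_×_)
import Data.List.Sort

-- Model of vector bundles on the Fargues–Fontaine curve X up to isomorphism,
-- via the classification (HN decomposition): a bundle is the list (multiset)
-- of slopes λ of its stable summands O(λ), counted with multiplicity.  Direct sum = list concatenation, 0 = [],
-- isomorphism = permutation of the list (uniqueness of HN decomposition).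
Bundle : Set
Bundle = List ℚ

-- rank of the stable bundle O(λ): for λ = d/r in lowest terms (r > 0), rk O(λ) = r.
rkO : ℚ → ℕ
rkO q = ↧ₙ q

-- slopes of HN(V) on the unit intervals [i-1,i], i = 1..rk V, before sorting:
-- each summand O(λ) contributes rk O(λ) unit edges of slope λ.
unitSlopes : Bundle → List ℚ
unitSlopes = concatMap (λ q → replicate (rkO q) q)

rank : Bundle → ℕ
rank V = length (unitSlopes V)

open Data.List.Sort ≤-decTotalOrder using (sort)

-- HN polygon slopes on [0,1],[1,2],…,[rk-1,rk]: decreasing order (concave polygon).
hnSlopes : Bundle → List ℚ
hnSlopes V = reverse (sort (unitSlopes V))

PrefixLE : List ℚ → List ℚ → Set
PrefixLE []       _        = ⊤
PrefixLE (w ∷ ws) []       = ⊥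
PrefixLE (w ∷ ws) (v ∷ vs) = (w ≤ v) × PrefixLE ws vs

-- V slopewise dominates W: for each i = 1..rk W, slope of HN(W) on [i-1,i]
-- is at most slope of HN(V) on [i-1,i] (which requires rk W ≤ rk V).
SlopewiseDominates : Bundle → Bundle → Set
SlopewiseDominates V W = PrefixLE (hnSlopes W) (hnSlopes V)

-- largest / smallest HN slope (junk value 0 on the zero bundle; only used on nonzero bundles)
μmax : Bundle → ℚ
μmax []       = 0ℚ
μmax (x ∷ xs) = foldr _⊔_ x xs

μmin : Bundle → ℚ
μmin []       = 0ℚ
μmin (x ∷ xs) = foldr _⊓_ x xs

{-# OPTIONS --safe #-}
-- Sort both bundles by decreasing slope.  For a bundle listed in decreasing order the HN
-- slope sequence is just its slopes, each repeated rank-many times, so slopewise dominance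
-- compares these sequences termwise.  Take U to be the longest common prefix of the two
-- sorted bundles: dominance survives cancelling U, the first remaining slopes differ and
-- are ordered by dominance, hence strictly, and in a decreasing list every slope of the
-- prefix bounds all later ones.
module Submission where

open import Defs
open import Data.Rational using (_≤_; _<_)
open import Data.List using (List; []; _++_)
open import Data.List.Relation.Binary.Permutation.Propositional using (_↭_)
open import Data.Product using (Σ; _×_)
open import Relation.Binary.PropositionalEquality using (_≢_)

open import Level using (Level)
open import Data.Nat using (zero; suc)
open import Function using (flip; _∘_)
open import Data.Unit.Polymorphic using (⊤; tt)
open import Data.Product using (_,_; proj₁)
open import Data.Rational using (ℚ; _≥_; _⊔_; _≟_)
open import Data.Rational.Properties
  using (≤-refl; <-cmp; <-irrefl; <-≤-trans; ⊓-glb; p≤q⇒p⊔q≡q; ≤-decTotalOrder)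
open import Data.List using (_∷_; replicate; reverse; concatMap)
open import Data.List.Properties using (concatMap-++; reverse-involutive; unfold-reverse; foldr-preservesᵇ)
import Data.List.Relation.Binary.Permutation.Propositional as ↭
open ↭ using (↭-refl; ↭-sym; ↭-trans; ↭-reflexive; ↭⇒↭ₛ)
open import Data.List.Relation.Binary.Permutation.Propositional.Properties
  using (++⁺ˡ; shifts; ↭-reverse; All-resp-↭)
open import Data.List.Relation.Unary.All as All using (All; []; _∷_)
import Data.List.Relation.Unary.All.Properties as All
open import Data.List.Relation.Unary.AllPairs as AllPairs using (AllPairs; []; _∷_)
import Data.List.Relation.Unary.AllPairs.Properties as AllPairs
open import Data.List.Relation.Unary.Sorted.TotalOrder using (Sorted)
open import Data.List.Relation.Unary.Sorted.TotalOrder.Properties using (AllPairs⇒Sorted; Sorted⇒AllPairs; ↗↭↗⇒≋)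
open import Data.List.Relation.Binary.Pointwise using (Pointwise-≡⇒≡)
open import Relation.Binary.Core using (Rel)
open import Relation.Binary.Bundles using (TotalOrder; DecTotalOrder)
open import Relation.Binary.Definitions using (Reflexive; DecidableEquality; tri<; tri≈; tri>)
open import Relation.Binary.PropositionalEquality using (_≡_; refl; sym; trans; cong; subst; subst₂; module ≡-Reasoning)
open import Relation.Binary.Properties.DecTotalOrder ≤-decTotalOrder using (≥-decTotalOrder; ≥-totalOrder)
open import Relation.Nullary using (yes; no; contradiction)
import Data.List.Sort

open Data.List.Sort ≤-decTotalOrder using (sort; sort-↭; sort-↗)
open Data.List.Sort ≥-decTotalOrder using () renaming (sort to sortDesc; sort-↭ to sortDesc-↭; sort-↗ to sortDesc-↗)

≤-totalOrder : TotalOrder _ _ _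
≤-totalOrder = DecTotalOrder.totalOrder ≤-decTotalOrder

private
  variable
    a b r : Level
    A : Set a
    B : Set b
    R : Rel A r
    x : A
    xs ys zs : List A
    p q : ℚ
    V W : Bundle

AllPairs-replicate⁺ : Reflexive R → ∀ n → AllPairs R (replicate n x)
AllPairs-replicate⁺ R-refl zero    = []
AllPairs-replicate⁺ R-refl (suc n) = All.replicate⁺ n R-refl ∷ AllPairs-replicate⁺ R-refl n

AllPairs-reverse⁺ : AllPairs R xs → AllPairs (flip R) (reverse xs)
AllPairs-reverse⁺ {xs = []}     []          = []
AllPairs-reverse⁺ {xs = x ∷ xs} (Rx ∷ Rxs) rewrite unfold-reverse x xs =
  AllPairs.++⁺ (AllPairs-reverse⁺ Rxs) ([] ∷ [])
    (All.map (_∷ []) (All-resp-↭ (↭-sym (↭-reverse xs)) Rx))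

AllPairs-++⁻ : ∀ xs → AllPairs R (xs ++ ys) → AllPairs R ys × All (λ x → All (R x) ys) xs
AllPairs-++⁻ []       Rys          = Rys , []
AllPairs-++⁻ (x ∷ xs) (Rx ∷ Rxsys) with Rys , Rxsys′ ← AllPairs-++⁻ xs Rxsys =
  Rys , All.++⁻ʳ xs Rx ∷ Rxsys′

PrefixLE-++⁻ : ∀ xs → PrefixLE (xs ++ ys) (xs ++ zs) → PrefixLE ys zs
PrefixLE-++⁻ []       le       = le
PrefixLE-++⁻ (x ∷ xs) (_ , le) = PrefixLE-++⁻ xs le

concatMap⁺ : (f : A → List B) → xs ↭ ys → concatMap f xs ↭ concatMap f ys
concatMap⁺ f ↭.refl         = ↭-refl
concatMap⁺ f (↭.prep x p)   = ++⁺ˡ (f x) (concatMap⁺ f p)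
concatMap⁺ f (↭.swap x y p) =
  ↭-trans (shifts (f x) (f y)) (++⁺ˡ (f y) (++⁺ˡ (f x) (concatMap⁺ f p)))
concatMap⁺ f (↭.trans p q)  = ↭-trans (concatMap⁺ f p) (concatMap⁺ f q)

Diverge : {A : Set a} → List A → List A → Set a
Diverge (x ∷ _) (y ∷ _) = x ≢ y
Diverge []      _       = ⊤
Diverge (_ ∷ _) []      = ⊤

record LongestCommonPrefix {A : Set a} (xs ys : List A) : Set a where
  field
    prefix xs′ ys′ : List A
    xs≡ : xs ≡ prefix ++ xs′
    ys≡ : ys ≡ prefix ++ ys′
    diverge : Diverge xs′ ys′

longestCommonPrefix : DecidableEquality A → (xs ys : List A) → LongestCommonPrefix xs ys
longestCommonPrefix _≟_ (x ∷ xs) (y ∷ ys) with x ≟ y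
... | no x≢y  = record { prefix = [] ; xs≡ = refl ; ys≡ = refl ; diverge = x≢y }
... | yes refl = record
  { prefix = x ∷ prefix ; xs′ = xs′ ; ys′ = ys′
  ; xs≡ = cong (x ∷_) xs≡ ; ys≡ = cong (x ∷_) ys≡ ; diverge = diverge }
  where open LongestCommonPrefix (longestCommonPrefix _≟_ xs ys)
longestCommonPrefix _≟_ []       ys       = record { prefix = [] ; xs≡ = refl ; ys≡ = refl ; diverge = tt }
longestCommonPrefix _≟_ (x ∷ xs) []       = record { prefix = [] ; xs≡ = refl ; ys≡ = refl ; diverge = tt }

≤∧≢⇒< : p ≤ q → p ≢ q → p < q
≤∧≢⇒< p≤q p≢q with <-cmp _ _
... | tri< p<q _   _   = p<q
... | tri≈ _   p≡q _   = contradiction p≡q p≢q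
... | tri> _   _   q<p = contradiction (<-≤-trans q<p p≤q) (<-irrefl refl)

sort-unique : Sorted ≤-totalOrder ys → xs ↭ ys → sort xs ≡ ys
sort-unique {xs = xs} ys↗ xs↭ys = Pointwise-≡⇒≡
  (↗↭↗⇒≋ ≤-totalOrder (sort-↗ xs) ys↗ (↭⇒↭ₛ (↭-trans (sort-↭ xs) xs↭ys)))

μmax-head : All (_≤ p) V → μmax (p ∷ V) ≡ p
μmax-head []           = refl
μmax-head {V = q ∷ _} (q≤p ∷ V≤p) = trans (cong (q ⊔_) (μmax-head V≤p)) (p≤q⇒p⊔q≡q q≤p)

μmin-glb : All (p ≤_) V → V ≢ [] → p ≤ μmin V
μmin-glb []          V≢[] = contradiction refl V≢[]
μmin-glb (p≤q ∷ p≤V) _    = foldr-preservesᵇ ⊓-glb p≤q p≤V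

Descending : List ℚ → Set
Descending = AllPairs _≥_

sortDesc-descending : ∀ V → Descending (sortDesc V)
sortDesc-descending V = Sorted⇒AllPairs ≥-totalOrder (sortDesc-↗ V)

hnSlopes-↭ : V ↭ W → hnSlopes V ≡ hnSlopes W
hnSlopes-↭ {W = W} V↭W =
  cong reverse (sort-unique (sort-↗ (unitSlopes W)) (↭-trans (concatMap⁺ _ V↭W) (↭-sym (sort-↭ _))))

dominates-resp-↭ : ∀ {V V′ W W′} → V ↭ V′ → W ↭ W′ → SlopewiseDominates V W → SlopewiseDominates V′ W′
dominates-resp-↭ V↭V′ W↭W′ = subst₂ PrefixLE (hnSlopes-↭ W↭W′) (hnSlopes-↭ V↭V′)

All-unitSlopes⁺ : {P : ℚ → Set} → All P V → All P (unitSlopes V)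
All-unitSlopes⁺ = All.concat⁺ ∘ All.map⁺ ∘ All.map (All.replicate⁺ _)

unitSlopes-descending : Descending V → Descending (unitSlopes V)
unitSlopes-descending {[]}    []          = []
unitSlopes-descending {a ∷ V} (a≥V ∷ dV) = AllPairs.++⁺
  (AllPairs-replicate⁺ ≤-refl (rkO a)) (unitSlopes-descending dV)
  (All.replicate⁺ (rkO a) (All-unitSlopes⁺ a≥V))

hnSlopes-descending : Descending V → hnSlopes V ≡ unitSlopes V
hnSlopes-descending {V} dV = begin
  reverse (sort L)     ≡⟨ cong reverse (sort-unique reverse-ascending (↭-sym (↭-reverse L))) ⟩
  reverse (reverse L)  ≡⟨ reverse-involutive L ⟩
  L                    ∎
  where
  open ≡-Reasoning
  L : List ℚ
  L = unitSlopes V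
  reverse-ascending : Sorted ≤-totalOrder (reverse L)
  reverse-ascending = AllPairs⇒Sorted ≤-totalOrder (AllPairs-reverse⁺ (unitSlopes-descending dV))

hnSlopes-descending-++ : ∀ U → Descending (U ++ V) → hnSlopes (U ++ V) ≡ unitSlopes U ++ hnSlopes V
hnSlopes-descending-++ {V} U dUV = begin
  hnSlopes (U ++ V)             ≡⟨ hnSlopes-descending dUV ⟩
  unitSlopes (U ++ V)           ≡⟨ concatMap-++ _ U V ⟩
  unitSlopes U ++ unitSlopes V  ≡⟨ cong (unitSlopes U ++_) (sym (hnSlopes-descending dV)) ⟩
  unitSlopes U ++ hnSlopes V    ∎
  where
  open ≡-Reasoning
  dV : Descending V
  dV = proj₁ (AllPairs-++⁻ U dUV)

dominates⇒unitSlopes : Descending V → Descending W → SlopewiseDominates V W →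
                       PrefixLE (unitSlopes W) (unitSlopes V)
dominates⇒unitSlopes dV dW = subst₂ PrefixLE (hnSlopes-descending dW) (hnSlopes-descending dV)

dominates-++⁻ : ∀ U → Descending (U ++ V) → Descending (U ++ W) →
                SlopewiseDominates (U ++ V) (U ++ W) → SlopewiseDominates V W
dominates-++⁻ U dUV dUW = PrefixLE-++⁻ (unitSlopes U)
  ∘ subst₂ PrefixLE (hnSlopes-descending-++ U dUW) (hnSlopes-descending-++ U dUV)

-- rkO w = ↧ₙ w is definitionally a successor, so unitSlopes (w ∷ W) reduces to w ∷ …
-- which lets the dominance hypotheses here and in μmax-gap be matched on directly.
dominated-nonzero : PrefixLE (unitSlopes W) (unitSlopes V) → W ≢ [] → V ≢ []
dominated-nonzero {[]}              _ W≢[] = contradiction refl W≢[]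
dominated-nonzero {_ ∷ _} {_ ∷ _} _ _    = λ ()

μmax-gap : Descending V → Descending W → PrefixLE (unitSlopes W) (unitSlopes V) →
           Diverge V W → W ≢ [] → μmax W < μmax V
μmax-gap {_}     {[]}    _          _          _         _   W≢[] = contradiction refl W≢[]
μmax-gap {[]}    {_ ∷ _} _          _          ()
μmax-gap {_ ∷ _} {_ ∷ _} (v≥V ∷ _) (w≥W ∷ _) (w≤v , _) v≢w _
  rewrite μmax-head v≥V | μmax-head w≥W = ≤∧≢⇒< w≤v (v≢w ∘ sym)

μmax≤μmin-prefix : ∀ U → Descending (U ++ V) → U ≢ [] → V ≢ [] → μmax V ≤ μmin U
μmax≤μmin-prefix {[]}    U _   _    V≢[] = contradiction refl V≢[]
μmax≤μmin-prefix {_ ∷ _} U dUV U≢[] _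
  with (v≥V ∷ _) , U≥vV ← AllPairs-++⁻ U dUV
  rewrite μmax-head v≥V = μmin-glb (All.map All.head U≥vV) U≢[]

Separated : Bundle → Bundle → Bundle → Set
Separated U V′ W′ =
  SlopewiseDominates V′ W′ ×
  (W′ ≢ [] → μmax W′ < μmax V′) ×
  (U ≢ [] → W′ ≢ [] → (μmax V′ ≤ μmin U) × (μmax W′ < μmax V′))

separated : ∀ U {V′ W′} → Descending (U ++ V′) → Descending (U ++ W′) →
            SlopewiseDominates (U ++ V′) (U ++ W′) → Diverge V′ W′ → Separated U V′ W′
separated U {V′} {W′} dUV′ dUW′ dom div =
  dom′ , gap , λ U≢[] W′≢[] → μmax≤μmin-prefix U dUV′ U≢[] (dominated-nonzero dom″ W′≢[]) , gap W′≢[]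
  where
  dV′ : Descending V′
  dV′ = proj₁ (AllPairs-++⁻ U dUV′)
  dW′ : Descending W′
  dW′ = proj₁ (AllPairs-++⁻ U dUW′)
  dom′ : SlopewiseDominates V′ W′
  dom′ = dominates-++⁻ U dUV′ dUW′ dom
  dom″ : PrefixLE (unitSlopes W′) (unitSlopes V′)
  dom″ = dominates⇒unitSlopes dV′ dW′ dom′
  gap : W′ ≢ [] → μmax W′ < μmax V′
  gap = μmax-gap dV′ dW′ dom″ div

lemma4p11 : (V W : Bundle) → SlopewiseDominates V W →
    Σ Bundle (λ U → Σ Bundle (λ V′ → Σ Bundle (λ W′ →
      (V ↭ (U ++ V′)) × (W ↭ (U ++ W′)) ×
      SlopewiseDominates V′ W′ ×
      (W′ ≢ [] → μmax W′ < μmax V′) ×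
      (U ≢ [] → W′ ≢ [] → (μmax V′ ≤ μmin U) × (μmax W′ < μmax V′)))))
lemma4p11 V W dom =
  U , V′ , W′ , V↭UV′ , W↭UW′ ,
  separated U (subst Descending xs≡ (sortDesc-descending V)) (subst Descending ys≡ (sortDesc-descending W))
    (dominates-resp-↭ V↭UV′ W↭UW′ dom) diverge
  where
  open LongestCommonPrefix (longestCommonPrefix _≟_ (sortDesc V) (sortDesc W))
    renaming (prefix to U; xs′ to V′; ys′ to W′)
  V↭UV′ : V ↭ U ++ V′
  V↭UV′ = ↭-trans (↭-sym (sortDesc-↭ V)) (↭-reflexive xs≡)
  W↭UW′ : W ↭ U ++ W′
  W↭UW′ = ↭-trans (↭-sym (sortDesc-↭ W)) (↭-reflexive ys≡)
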